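{- Let $A,B\subseteq 2^{<\omega}\times\omega^{<\omega}$. Then $\mathrm{cl}_p(A\cup B)=\mathrm{cl}_p(A)\cup\mathrm{cl}_p(B)$.
   Context: For $B\subseteq 2^{<\omega}\times\omega^{<\omega}$ define by transfinite recursion: $R_0=B$, and for $\alpha>0$, $R_\alpha$ is the set of pairs $(\sigma,\tau)$ such that there is $\sigma'\succ\sigma$ such that for every $\sigma''\succeq\sigma'$ there is $\sigma'''\succeq\sigma''$ such that for infinitely many $n$, $(\sigma''',\tau^\frown n)\in\bigcup_{\beta<\alpha}R_\beta$. $\mathrm{cl}_p(B)=\bigcup_{\alpha}R_\alpha$ (the set of pairs with a $B$-rank). -}

module Defs where

open import Data.Bool using (Bool)
open import Data.Nat using (ℕ; _≤_)
open import Data.List using (List; []; _∷_; _++_; [_])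
open import Data.Product using (Σ; _×_; _,_)
open import Relation.Binary.PropositionalEquality using (_≡_; _≢_)

Str₂ : Set
Str₂ = List Bool

Strω : Set
Strω = List ℕ

Pair : Set
Pair = Str₂ × Strω

Subset : Set₁
Subset = Pair → Set

_⪯_ : Str₂ → Str₂ → Set
σ ⪯ σ' = Σ Str₂ λ ρ → σ' ≡ σ ++ ρ

_≺_ : Str₂ → Str₂ → Set
σ ≺ σ' = Σ Str₂ λ ρ → (ρ ≢ []) × (σ' ≡ σ ++ ρ)

InfinitelyMany : (ℕ → Set) → Set
InfinitelyMany P = (m : ℕ) → Σ ℕ λ n → (m ≤ n) × P n

Step : Subset → Str₂ → Strω → Set
Step X σ τ =
  Σ Str₂ λ σ' → (σ ≺ σ') ×
    ((σ'' : Str₂) → σ' ⪯ σ'' →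
      Σ Str₂ λ σ''' → (σ'' ⪯ σ''') ×
        InfinitelyMany (λ n → X (σ''' , τ ++ [ n ])))

-- cl_p(B) = ⋃_α R_α, the set of pairs having a B-rank.  Its elements are
-- exactly those obtained by well-founded iteration: R_0 = B, and a pair
-- enters at a later stage when it satisfies Step relative to the union of
-- the earlier stages.  The inductive family below is this transfinite
-- iteration (a derivation tree is a rank witness).
data ClP (B : Subset) : Subset where
  base : ∀ {p} → B p → ClP B p
  step : ∀ {σ τ} → Step (ClP B) σ τ → ClP B (σ , τ)

_∪_ : Subset → Subset → Subset
(A ∪ B) p = Data.Sum._⊎_ (A p) (B p)
  where import Data.Sum

{-# OPTIONS --safe #-}
module Submission where

-- The derivation step distributes over unions. If the pairs hitting A ∪ B
-- infinitely often are dense above σ', then either those hitting A are dense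
-- above some extension of σ', so the A-step applies, or every extension of σ'
-- has one above which nothing hits A infinitely often; there, by the infinite
-- pigeonhole principle, the (A ∪ B)-hits are B-hits. Induction over
-- derivations in cl_p(A ∪ B) then gives cl_p(A ∪ B) ⊆ cl_p(A) ∪ cl_p(B), and
-- the converse is monotonicity of cl_p.

open import Defs
open import Axiom.DoubleNegationElimination using (DoubleNegationElimination; em⇒dne)
open import Axiom.ExcludedMiddle using (ExcludedMiddle)
open import Data.List using (_++_; [_])
open import Data.List.Properties using (++-assoc; ++-conicalˡ)
open import Data.Nat using (ℕ; _≤_; _⊔_)
open import Data.Nat.Properties using (≤-trans; m≤m⊔n; m≤n⊔m)
open import Data.Product using (Σ; _×_; _,_)
open import Data.Sum using (_⊎_; inj₁; inj₂)
import Data.Sum as Sum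
open import Function using (_∘_)
open import Level using (0ℓ)
open import Relation.Binary.PropositionalEquality using (refl)
open import Relation.Nullary using (¬_; yes; no)
open import Relation.Unary using (_⊆_)

⪯-trans : ∀ {σ σ' σ''} → σ ⪯ σ' → σ' ⪯ σ'' → σ ⪯ σ''
⪯-trans {σ} (ρ , refl) (ρ' , refl) = ρ ++ ρ' , ++-assoc σ ρ ρ'

≺-⪯-trans : ∀ {σ σ' σ''} → σ ≺ σ' → σ' ⪯ σ'' → σ ≺ σ''
≺-⪯-trans {σ} (ρ , ρ≢[] , refl) (ρ' , refl) =
  ρ ++ ρ' , ρ≢[] ∘ ++-conicalˡ ρ ρ' , ++-assoc σ ρ ρ'

InfinitelyMany-⊎ : DoubleNegationElimination 0ℓ → {P Q : ℕ → Set} →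
  InfinitelyMany (λ n → P n ⊎ Q n) → ¬ InfinitelyMany P → InfinitelyMany Q
InfinitelyMany-⊎ dne {P} {Q} inf ¬infP m = dne λ ¬Q≥m → ¬infP λ m' → dne λ ¬P≥m' →
  refute ¬Q≥m ¬P≥m' (inf (m ⊔ m'))
  where
  refute : ∀ {m'} → ¬ Σ ℕ (λ n → m ≤ n × Q n) → ¬ Σ ℕ (λ n → m' ≤ n × P n) →
    ¬ Σ ℕ (λ n → m ⊔ m' ≤ n × (P n ⊎ Q n))
  refute {m'} _ ¬P≥m' (n , m⊔m'≤n , inj₁ p) = ¬P≥m' (n , ≤-trans (m≤n⊔m m m') m⊔m'≤n , p)
  refute {m'} ¬Q≥m _ (n , m⊔m'≤n , inj₂ q) = ¬Q≥m (n , ≤-trans (m≤m⊔n m m') m⊔m'≤n , q)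

Dense : (Str₂ → Set) → Str₂ → Set
Dense Q σ = (σ' : Str₂) → σ ⪯ σ' → Σ Str₂ λ σ'' → σ' ⪯ σ'' × Q σ''

-- In the second case every extension of σ has an extension above which U never
-- holds, and there the W-witnesses supplied by density are V-witnesses.
Dense-split : ExcludedMiddle 0ℓ → {U V W : Str₂ → Set} →
  (∀ {σ} → W σ → ¬ U σ → V σ) → ∀ {σ} → Dense W σ →
  (Σ Str₂ λ σ' → σ ⪯ σ' × Dense U σ') ⊎ Dense V σ
Dense-split em {U} {V} W∖U⊆V {σ} denseW with em {Σ Str₂ λ σ' → σ ⪯ σ' × Dense U σ'}
... | yes denseU = inj₁ denseU
... | no ¬denseU = inj₂ λ σ' σ⪯σ' → dne λ ¬V≥σ' → ¬denseU (σ' , σ⪯σ' , λ σ'' σ'⪯σ'' →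
        dne λ ¬U≥σ'' → ¬V≥σ' (V-above σ⪯σ' σ'⪯σ'' ¬U≥σ''))
  where
  dne : DoubleNegationElimination 0ℓ
  dne = em⇒dne em
  V-above : ∀ {σ' σ''} → σ ⪯ σ' → σ' ⪯ σ'' → ¬ Σ Str₂ (λ σ''' → σ'' ⪯ σ''' × U σ''') →
    Σ Str₂ λ σ''' → σ' ⪯ σ''' × V σ'''
  V-above σ⪯σ' σ'⪯σ'' ¬U≥σ'' with denseW _ (⪯-trans σ⪯σ' σ'⪯σ'')
  ... | σ''' , σ''⪯σ''' , w =
    σ''' , ⪯-trans σ'⪯σ'' σ''⪯σ''' , W∖U⊆V w (λ u → ¬U≥σ'' (σ''' , σ''⪯σ''' , u))

-- Step X σ τ unfolds to  Σ σ' , σ ≺ σ' × Dense (Hits X τ) σ'.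
Hits : Subset → Strω → Str₂ → Set
Hits X τ σ = InfinitelyMany λ n → X (σ , τ ++ [ n ])

Step-∪ : ExcludedMiddle 0ℓ → {X Y : Subset} → ∀ {σ τ} →
  Step (X ∪ Y) σ τ → Step X σ τ ⊎ Step Y σ τ
Step-∪ em (σ' , σ≺σ' , dense) =
  Sum.map (λ (σ'' , σ'⪯σ'' , denseX) → σ'' , ≺-⪯-trans σ≺σ' σ'⪯σ'' , denseX)
          (λ denseY → σ' , σ≺σ' , denseY)
          (Dense-split em (InfinitelyMany-⊎ (em⇒dne em)) dense)

module _ {B : Subset} (P : Subset) (base* : B ⊆ P)
         (step* : ∀ {σ τ} → Step P σ τ → P (σ , τ)) where

  -- The recursion is threaded through Step by pattern matching rather than a
  -- map over Step, so that the termination checker sees it is structural.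
  ClP-rec : ClP B ⊆ P
  ClP-rec (base b) = base* b
  ClP-rec (step (σ' , σ≺σ' , dense)) =
    step* (σ' , σ≺σ' , λ σ'' σ'⪯σ'' → rec-hits (dense σ'' σ'⪯σ''))
    where
    rec-hits : ∀ {σ'' τ} → Σ Str₂ (λ σ''' → σ'' ⪯ σ''' × Hits (ClP B) τ σ''') →
      Σ Str₂ λ σ''' → σ'' ⪯ σ''' × Hits P τ σ'''
    rec-hits (σ''' , σ''⪯σ''' , hits) = σ''' , σ''⪯σ''' , λ m → rec-child (hits m)
      where
      rec-child : ∀ {m τ} → Σ ℕ (λ n → m ≤ n × ClP B (σ''' , τ ++ [ n ])) →
        Σ ℕ λ n → m ≤ n × P (σ''' , τ ++ [ n ])
      rec-child (n , m≤n , c) = n , m≤n , ClP-rec c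

ClP-mono : {A C : Subset} → A ⊆ C → ClP A ⊆ ClP C
ClP-mono {C = C} A⊆C = ClP-rec (ClP C) (base ∘ A⊆C) step

ClP-∪ : ExcludedMiddle 0ℓ → {A B : Subset} → ClP (A ∪ B) ⊆ ClP A ∪ ClP B
ClP-∪ em {A} {B} =
  ClP-rec (ClP A ∪ ClP B) (Sum.map base base) (Sum.map step step ∘ Step-∪ em {ClP A} {ClP B})

lemma6p11 : ExcludedMiddle 0ℓ → (A B : Subset) → (p : Pair) →
    ((ClP (A ∪ B) p → ClP A p ⊎ ClP B p) × (ClP A p ⊎ ClP B p → ClP (A ∪ B) p))
lemma6p11 em A B p = ClP-∪ em , Sum.[ ClP-mono inj₁ , ClP-mono inj₂ ]
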